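{- Let $G$ be a looped simple graph with a transverse matroid $M$. Then every matroid minor of $M$ is a transverse matroid of some vertex-minor of $G$.
   Context: A looped simple graph is a finite graph with loops allowed but no two edges on the same set of end-vertices; neighbors are distinct adjacent vertices. $A(G)$ is the adjacency matrix over $GF(2)$ with diagonal entry $1$ exactly at looped vertices. $IAS(G)=(I\;A(G)\;A(G)+I)$ over $GF(2)$, with $v$ columns labeled $\phi_G(v),\chi_G(v),\psi_G(v)$; $W(G)$ is the set of labels and $M[IAS(G)]$ the binary matroid on $W(G)$ represented by $IAS(G)$. A transversal is a subset of $W(G)$ containing exactly one element of each vertex triple $\{\phi_G(v),\chi_G(v),\psi_G(v)\}$; a transverse matroid of $G$ is the restriction of $M[IAS(G)]$ to a transversal. For $v\in V(G)$: $G^v_\ell$ complements the loop status of $v$; $G^v_s$ complements the adjacency status of every pair of distinct neighbors of $v$; $G^v_{ns}$ does the same and also complements the loop status of every neighbor of $v$. A vertex-minor of $G$ is a graph obtained from $G$ through a sequence of these loop and local complementations and vertex deletions. -}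

module Defs where

open import Data.Nat using (ℕ; zero; suc)
open import Data.Fin using (Fin; zero; suc; punchIn; punchOut; _≟_)
open import Data.Bool using (Bool; true; false; _∧_; _xor_; not; if_then_else_)
open import Data.Product using (Σ; _×_)
open import Relation.Nullary using (¬_; yes; no)
open import Relation.Nullary.Decidable using (⌊_⌋)
open import Relation.Binary.PropositionalEquality using (_≡_)
open import Function using (_∘_)
open import Function.Bundles using (_⇔_; _↔_; Inverse)

-- GF(2) = Bool with xor as addition, ∧ as multiplication.

_==_ : ∀ {n} → Fin n → Fin n → Bool
i == j = ⌊ i ≟ j ⌋

xorSum : ∀ {k} → (Fin k → Bool) → Bool
xorSum {zero}  f = false
xorSum {suc k} f = f zero xor xorSum (f ∘ suc)

-- Looped simple graphs on vertex set Fin n, via their GF(2) adjacency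
-- matrix A(G): A i j = true iff i,j adjacent (i ≠ j) or i = j is looped.

Mat : ℕ → Set
Mat n = Fin n → Fin n → Bool

-- A(G) of a looped simple graph is exactly a symmetric Boolean matrix.
SymmetricMat : ∀ {n} → Mat n → Set
SymmetricMat A = ∀ i j → A i j ≡ A j i

nbr : ∀ {n} → Mat n → Fin n → Fin n → Bool
nbr A v i = A v i ∧ not (i == v)

loopComp : ∀ {n} → Mat n → Fin n → Mat n
loopComp A v i j = A i j xor ((i == v) ∧ (j == v))

-- G^v_s : complement adjacency of every pair of distinct neighbors of v
sComp : ∀ {n} → Mat n → Fin n → Mat n
sComp A v i j = A i j xor (nbr A v i ∧ nbr A v j ∧ not (i == j))

-- G^v_ns : as G^v_s, and also complement the loop status of every neighbor of v
nsComp : ∀ {n} → Mat n → Fin n → Mat n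
nsComp A v i j = A i j xor (nbr A v i ∧ nbr A v j)

-- G - v (vertices of G - v are renumbered by punchIn v)
delV : ∀ {n} → Mat (suc n) → Fin (suc n) → Mat n
delV A v i j = A (punchIn v i) (punchIn v j)

data VertexMinor {n} (A : Mat n) : ∀ {m} → Mat m → Set where
  vm-refl : VertexMinor A A
  vm-loop : ∀ {m} {B : Mat m} → VertexMinor A B → (v : Fin m) → VertexMinor A (loopComp B v)
  vm-s    : ∀ {m} {B : Mat m} → VertexMinor A B → (v : Fin m) → VertexMinor A (sComp B v)
  vm-ns   : ∀ {m} {B : Mat m} → VertexMinor A B → (v : Fin m) → VertexMinor A (nsComp B v)
  vm-del  : ∀ {m} {B : Mat (suc m)} → VertexMinor A B → (v : Fin (suc m)) → VertexMinor A (delV B v)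

-- Matroids on ground set Fin k, given by their independence predicate on
-- subsets (subsets are characteristic functions Fin k → Bool).

Subset : ℕ → Set
Subset k = Fin k → Bool

_⊆_ : ∀ {k} → Subset k → Subset k → Set
T ⊆ S = ∀ i → T i ≡ true → S i ≡ true

Matroid : ℕ → Set₁
Matroid k = Subset k → Set

-- Binary matroid represented by columns c i ∈ GF(2)^n, i ∈ Fin k:
-- S is independent iff the columns indexed by S are linearly independent over
-- GF(2), i.e. the only subset T ⊆ S whose columns sum to 0 is the empty one.
binaryMatroid : ∀ {k n} → (Fin k → Fin n → Bool) → Matroid k
binaryMatroid c S =
  ∀ (T : Subset _) → T ⊆ S → (∀ j → xorSum (λ i → T i ∧ c i j) ≡ false) → ∀ i → T i ≡ false

-- IAS(G) = (I  A  A+I); a transversal picks, for each vertex v, one of the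
-- columns φ_G(v), χ_G(v), ψ_G(v).

data Label : Set where
  φ χ ψ : Label

Transversal : ℕ → Set
Transversal n = Fin n → Label

iasColumn : ∀ {n} → Mat n → Label → Fin n → Fin n → Bool
iasColumn A φ v j = j == v
iasColumn A χ v j = A j v
iasColumn A ψ v j = A j v xor (j == v)

-- The transverse matroid M[IAS(G)] | T, whose element T(v) is indexed by v.
transverseMatroid : ∀ {n} → Mat n → Transversal n → Matroid n
transverseMatroid A τ = binaryMatroid (λ v → iasColumn A (τ v) v)

singleton : ∀ {k} → Fin k → Subset k
singleton e i = i == e

-- the subset S of Fin k viewed inside Fin (suc k) with e removed, plus b at e
extendAt : ∀ {k} → Fin (suc k) → Bool → Subset k → Subset (suc k)
extendAt e b S i with e ≟ i
... | yes _  = b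
... | no e≢i = S (punchOut e≢i)

deleteM : ∀ {k} → Matroid (suc k) → Fin (suc k) → Matroid k
deleteM M e S = M (extendAt e false S)

-- M / e  (if e is a loop, M / e = M \ e; otherwise I is independent iff I ∪ e is)
contractM : ∀ {k} → Matroid (suc k) → Fin (suc k) → Matroid k
contractM M e S =
  (M (singleton e) → M (extendAt e true S)) × (¬ M (singleton e) → M (extendAt e false S))

data Minor {k} (M : Matroid k) : ∀ {m} → Matroid m → Set₁ where
  mn-refl : Minor M M
  mn-del  : ∀ {m} {N : Matroid (suc m)} → Minor M N → (e : Fin (suc m)) → Minor M (deleteM N e)
  mn-con  : ∀ {m} {N : Matroid (suc m)} → Minor M N → (e : Fin (suc m)) → Minor M (contractM N e)

_≅M_ : ∀ {m} → Matroid m → Matroid m → Set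
_≅M_ {m} N N' = Σ (Fin m ↔ Fin m) λ σ → ∀ (S : Subset m) → N S ⇔ N' (S ∘ Inverse.from σ)

module Submission where

-- By induction on the minor it suffices to realise a single deletion M \ v and a
-- single contraction M / v of a transverse matroid M = M[IAS(B)] | τ of a looped
-- simple graph B (a symmetric matrix) as transverse matroids of vertex-minors of B.
-- Two facts about IAS drive this.
--  * A local complementation at w acts on IAS(B) by row operations together with a
--    permutation of the three labels of w, and a loop complementation at w only
--    permutes the labels of w; so both keep the transverse matroid once the label of
--    w is adjusted (`ns-preserves`, `loop-preserves`).
--  * Contracting an element whose column is the unit vector φ(v) deletes v from the
--    graph (`UnitColumn.contract`, `contract-φ`).
-- Contraction: a zero column is a loop, and then M / v = M \ v.  Otherwise a few
-- local complementations move the label of v to φ (`makeφ`).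
-- Deletion: by the key lemma `φχ-not-both-spanned`, one of φ(v), χ(v) lies outside
-- the span of the other elements of τ; choosing that label at v does not change
-- M \ v and makes v a coloop, so M \ v = M / v, which is the contraction case.

open import Defs
open import Level using (0ℓ)
open import Data.Nat using (ℕ; zero; suc)
open import Data.Fin using (Fin; zero; suc; punchIn; punchOut; _≟_)
open import Data.Fin.Properties using (punchInᵢ≢i; punchIn-injective; punchIn-punchOut; punchOut-cong; punchOut-punchIn; all?; any?)
open import Data.Fin.Subset.Properties using (anySubset?)
open import Data.Bool using (Bool; true; false; _∧_; _xor_; not; if_then_else_)
open import Data.Bool.Properties using (xor-∧-commutativeRing; xor-identityʳ; xor-same; ∧-zeroʳ; ∧-identityʳ; ∧-distribˡ-xor; ∧-comm; xor-comm; ¬-not) renaming (_≟_ to _≟ᴮ_)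
open import Data.Maybe using (just; nothing)
open import Data.Vec using (lookup; tabulate)
open import Data.Vec.Properties using (lookup∘tabulate)
open import Data.Product using (Σ; _×_; _,_; proj₁; proj₂)
open import Data.Sum using (_⊎_; inj₁; inj₂)
open import Data.Empty using (⊥-elim)
open import Relation.Nullary using (¬_; Dec; yes; no)
open import Relation.Nullary.Decidable using (map′)
open import Relation.Binary.PropositionalEquality
open import Function using (_∘_; case_of_)
open import Function.Bundles using (_⇔_; mk⇔; Equivalence)
open import Function.Construct.Identity using (⇔-id; ↔-id)
open import Function.Construct.Composition using (_⇔-∘_)
open import Tactic.RingSolver using (solve-∀)
open import Tactic.RingSolver.Core.AlmostCommutativeRing using (AlmostCommutativeRing; fromCommutativeRing)

open ≡-Reasoning
open Equivalence using (to; from)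

GF2 : AlmostCommutativeRing 0ℓ 0ℓ
GF2 = fromCommutativeRing xor-∧-commutativeRing λ { false → just refl ; true → nothing }

xor-interchange : ∀ a b c d → (a xor b) xor (c xor d) ≡ (a xor c) xor (b xor d)
xor-interchange = solve-∀ GF2

xor-leftComm : ∀ a b c → a xor (b xor c) ≡ b xor (a xor c)
xor-leftComm = solve-∀ GF2

xor-solve : ∀ a b e → a xor b ≡ e → b ≡ a xor e
xor-solve false b e eq = eq
xor-solve true false _ refl = refl
xor-solve true true _ refl = refl

-- Sums over GF(2)

xorSum-cong : ∀ {k} {f g : Fin k → Bool} → (∀ i → f i ≡ g i) → xorSum f ≡ xorSum g
xorSum-cong {zero}  eq = refl
xorSum-cong {suc k} eq = cong₂ _xor_ (eq zero) (xorSum-cong (eq ∘ suc))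

xorSum-zero : ∀ {k} → xorSum {k} (λ _ → false) ≡ false
xorSum-zero {zero}  = refl
xorSum-zero {suc k} = xorSum-zero {k}

xorSum-xor : ∀ {k} (f g : Fin k → Bool) → xorSum (λ i → f i xor g i) ≡ xorSum f xor xorSum g
xorSum-xor {zero}  f g = refl
xorSum-xor {suc k} f g =
  trans (cong ((f zero xor g zero) xor_) (xorSum-xor (f ∘ suc) (g ∘ suc)))
        (xor-interchange (f zero) (g zero) (xorSum (f ∘ suc)) (xorSum (g ∘ suc)))

xorSum-scale : ∀ {k} b (f : Fin k → Bool) → xorSum (λ i → b ∧ f i) ≡ b ∧ xorSum f
xorSum-scale {zero}  b f = sym (∧-zeroʳ b)
xorSum-scale {suc k} b f =
  trans (cong ((b ∧ f zero) xor_) (xorSum-scale b (f ∘ suc)))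
        (sym (∧-distribˡ-xor b (f zero) (xorSum (f ∘ suc))))

xorSum-split : ∀ {k} (v : Fin (suc k)) (f : Fin (suc k) → Bool) → xorSum f ≡ f v xor xorSum (f ∘ punchIn v)
xorSum-split zero f = refl
xorSum-split {suc k} (suc v) f =
  trans (cong (f zero xor_) (xorSum-split v (f ∘ suc)))
        (xor-leftComm (f zero) (f (suc v)) (xorSum (f ∘ suc ∘ punchIn v)))

xorSum-point : ∀ {k} (v : Fin (suc k)) (f : Fin (suc k) → Bool) → (∀ u → f (punchIn v u) ≡ false) → xorSum f ≡ f v
xorSum-point {k} v f off = begin
  xorSum f                         ≡⟨ xorSum-split v f ⟩
  f v xor xorSum (f ∘ punchIn v)   ≡⟨ cong (f v xor_) (trans (xorSum-cong off) (xorSum-zero {k})) ⟩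
  f v xor false                    ≡⟨ xor-identityʳ (f v) ⟩
  f v                              ∎

xorSum-swap : ∀ {k l} (f : Fin k → Fin l → Bool) → xorSum (λ i → xorSum (f i)) ≡ xorSum (λ j → xorSum (λ i → f i j))
xorSum-swap {zero}  {l} f = sym (xorSum-zero {l})
xorSum-swap {suc k}     f =
  trans (cong (xorSum (f zero) xor_) (xorSum-swap (f ∘ suc)))
        (sym (xorSum-xor (f zero) (λ j → xorSum (λ i → f (suc i) j))))

==-refl : ∀ {n} (i : Fin n) → (i == i) ≡ true
==-refl i with i ≟ i
... | yes _  = refl
... | no i≢i = ⊥-elim (i≢i refl)

==-no : ∀ {n} {i j : Fin n} → ¬ (i ≡ j) → (i == j) ≡ false
==-no {i = i} {j} i≢j with i ≟ j
... | yes i≡j = ⊥-elim (i≢j i≡j)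
... | no _    = refl

==⇒≡ : ∀ {n} {i j : Fin n} → (i == j) ≡ true → i ≡ j
==⇒≡ {i = i} {j} eq with i ≟ j
... | yes i≡j = i≡j
... | no _    = case eq of λ ()

punchIn==v : ∀ {n} (v : Fin (suc n)) u → (punchIn v u == v) ≡ false
punchIn==v v u = ==-no (punchInᵢ≢i v u)

v==punchIn : ∀ {n} (v : Fin (suc n)) u → (v == punchIn v u) ≡ false
v==punchIn v u = ==-no (punchInᵢ≢i v u ∘ sym)

punchIn-== : ∀ {n} (v : Fin (suc n)) u w → (punchIn v u == punchIn v w) ≡ (u == w)
punchIn-== v u w with u ≟ w | punchIn v u ≟ punchIn v w
... | yes _   | yes _ = refl
... | no _    | no _  = refl
... | yes u≡w | no ne = ⊥-elim (ne (cong (punchIn v) u≡w))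
... | no u≢w  | yes e = ⊥-elim (u≢w (punchIn-injective v u w e))

punchIn-cases : ∀ {n} (v : Fin (suc n)) (P : Fin (suc n) → Set) → P v → (∀ u → P (punchIn v u)) → ∀ j → P j
punchIn-cases v P pv pu j with v ≟ j
... | yes refl = pv
... | no v≢j   = subst P (punchIn-punchOut v≢j) (pu (punchOut v≢j))

extendAt-at : ∀ {k} (v : Fin (suc k)) b S → extendAt v b S v ≡ b
extendAt-at v b S with v ≟ v
... | yes _  = refl
... | no v≢v = ⊥-elim (v≢v refl)

extendAt-punchIn : ∀ {k} (v : Fin (suc k)) b S u → extendAt v b S (punchIn v u) ≡ S u
extendAt-punchIn v b S u with v ≟ punchIn v u
... | yes e  = ⊥-elim (punchInᵢ≢i v u (sym e))
... | no v≢u = cong S (trans (punchOut-cong v refl) (punchOut-punchIn v))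

extendAt-⊆ : ∀ {k} (v : Fin (suc k)) b {T S : Subset k} → T ⊆ S → extendAt v b T ⊆ extendAt v true S
extendAt-⊆ v b T⊆S i with v ≟ i
... | yes _ = λ _ → refl
... | no v≢i = T⊆S (punchOut v≢i)

-- Matroids with the same independent sets, and contraction

_≈M_ : ∀ {k} → Matroid k → Matroid k → Set
M ≈M N = ∀ S → M S ⇔ N S

≈M-refl : ∀ {k} {M : Matroid k} → M ≈M M
≈M-refl S = ⇔-id _

≈M-trans : ∀ {k} {M N P : Matroid k} → M ≈M N → N ≈M P → M ≈M P
≈M-trans M≈N N≈P S = N≈P S ⇔-∘ M≈N S

contractM-cong : ∀ {m} {M N : Matroid (suc m)} e → M ≈M N → contractM M e ≈M contractM N e
contractM-cong e M≈N S = mk⇔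
  (λ (ifInd , ifLoop) → (λ ind → to (M≈N _) (ifInd (from (M≈N _) ind))) , λ dep → to (M≈N _) (ifLoop (dep ∘ to (M≈N _))))
  (λ (ifInd , ifLoop) → (λ ind → from (M≈N _) (ifInd (to (M≈N _) ind))) , λ dep → from (M≈N _) (ifLoop (dep ∘ from (M≈N _))))

contract-nonloop : ∀ {m} (M : Matroid (suc m)) e → M (singleton e) → contractM M e ≈M (λ S → M (extendAt e true S))
contract-nonloop M e ind S = mk⇔ (λ c → proj₁ c ind) (λ x → (λ _ → x) , λ dep → ⊥-elim (dep ind))

contract-loop : ∀ {m} (M : Matroid (suc m)) e → ¬ M (singleton e) → contractM M e ≈M deleteM M e
contract-loop M e dep S = mk⇔ (λ c → proj₂ c dep) (λ x → (λ ind → ⊥-elim (dep ind)) , λ _ → x)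

-- Binary matroids

Columns : ℕ → ℕ → Set
Columns k n = Fin k → Fin n → Bool

colSum : ∀ {k n} → Columns k n → Subset k → Fin n → Bool
colSum c T j = xorSum (λ i → T i ∧ c i j)

Dependency : ∀ {k n} → Columns k n → Subset k → Set
Dependency c T = ∀ j → colSum c T j ≡ false

sameDependencies : ∀ {k n n'} (c : Columns k n) (d : Columns k n') S
                 → (∀ T → T ⊆ S → Dependency c T → Dependency d T)
                 → (∀ T → T ⊆ S → Dependency d T → Dependency c T)
                 → binaryMatroid c S ⇔ binaryMatroid d S
sameDependencies c d S c⇒d d⇒c = mk⇔
  (λ ind T T⊆S dep → ind T T⊆S (d⇒c T T⊆S dep))
  (λ ind T T⊆S dep → ind T T⊆S (c⇒d T T⊆S dep))

colSum-cong : ∀ {k n} {c d : Columns k n} → (∀ i j → c i j ≡ d i j) → ∀ T j → colSum c T j ≡ colSum d T j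
colSum-cong c≡d T j = xorSum-cong λ i → cong (T i ∧_) (c≡d i j)

colSum-split : ∀ {k n} (c : Columns (suc k) n) v T j
             → colSum c T j ≡ (T v ∧ c v j) xor colSum (c ∘ punchIn v) (T ∘ punchIn v) j
colSum-split c v T j = xorSum-split v (λ i → T i ∧ c i j)

colSum-extendAt : ∀ {k n} (c : Columns (suc k) n) v b T j
                → colSum c (extendAt v b T) j ≡ (b ∧ c v j) xor colSum (c ∘ punchIn v) T j
colSum-extendAt c v b T j = trans (colSum-split c v (extendAt v b T) j)
  (cong₂ (λ x y → (x ∧ c v j) xor y) (extendAt-at v b T)
         (xorSum-cong λ u → cong (_∧ c (punchIn v u) j) (extendAt-punchIn v b T u)))

sameColumns : ∀ {k n} (c d : Columns k n) → (∀ i j → c i j ≡ d i j) → binaryMatroid c ≈M binaryMatroid d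
sameColumns c d c≡d S = sameDependencies c d S
  (λ T _ dep j → trans (sym (colSum-cong c≡d T j)) (dep j))
  (λ T _ dep j → trans (colSum-cong c≡d T j) (dep j))

avoiding-column : ∀ {k n} (c d : Columns (suc k) n) v → (∀ u j → c (punchIn v u) j ≡ d (punchIn v u) j)
                → ∀ S → binaryMatroid c (extendAt v false S) ⇔ binaryMatroid d (extendAt v false S)
avoiding-column c d v c≡d S = sameDependencies c d _ (transfer c d c≡d) (transfer d c (λ u j → sym (c≡d u j)))
  where
    transfer : ∀ c d → (∀ u j → c (punchIn v u) j ≡ d (punchIn v u) j)
             → ∀ T → T ⊆ extendAt v false S → Dependency c T → Dependency d T
    transfer c d c≡d T T⊆S dep j = begin
      colSum d T j                                                 ≡⟨ colSum-split d v T j ⟩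
      (T v ∧ d v j) xor colSum (d ∘ punchIn v) (T ∘ punchIn v) j   ≡⟨ cong₂ (λ x y → (x ∧ d v j) xor y) Tv≡false
                                                                        (sym (colSum-cong c≡d (T ∘ punchIn v) j)) ⟩
      colSum (c ∘ punchIn v) (T ∘ punchIn v) j                     ≡⟨ cong₂ (λ x y → (x ∧ c v j) xor y) (sym Tv≡false) refl ⟩
      (T v ∧ c v j) xor colSum (c ∘ punchIn v) (T ∘ punchIn v) j   ≡⟨ sym (colSum-split c v T j) ⟩
      colSum c T j                                                 ≡⟨ dep j ⟩
      false                                                        ∎
      where
        Tv≡false : T v ≡ false
        Tv≡false = ¬-not λ Tv → case trans (sym (T⊆S v Tv)) (extendAt-at v false S) of λ ()

rowOperation : ∀ {k n} (c d : Columns k n) (a : Fin n → Bool) v → a v ≡ false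
             → (∀ i j → d i j ≡ c i j xor (a j ∧ c i v)) → binaryMatroid c ≈M binaryMatroid d
rowOperation c d a v av≡false d≡ S = sameDependencies c d S (λ T _ → forward T) (λ T _ → backward T)
  where
    colSum-d : ∀ T j → colSum d T j ≡ colSum c T j xor (a j ∧ colSum c T v)
    colSum-d T j = begin
      xorSum (λ i → T i ∧ d i j)                               ≡⟨ xorSum-cong (λ i → cong (T i ∧_) (d≡ i j)) ⟩
      xorSum (λ i → T i ∧ (c i j xor (a j ∧ c i v)))           ≡⟨ xorSum-cong (λ i → distrib (T i) (c i j) (a j) (c i v)) ⟩
      xorSum (λ i → (T i ∧ c i j) xor (a j ∧ (T i ∧ c i v)))   ≡⟨ xorSum-xor (λ i → T i ∧ c i j) (λ i → a j ∧ (T i ∧ c i v)) ⟩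
      colSum c T j xor xorSum (λ i → a j ∧ (T i ∧ c i v))      ≡⟨ cong (colSum c T j xor_) (xorSum-scale (a j) (λ i → T i ∧ c i v)) ⟩
      colSum c T j xor (a j ∧ colSum c T v)                    ∎
      where
        distrib : ∀ t x b y → t ∧ (x xor (b ∧ y)) ≡ (t ∧ x) xor (b ∧ (t ∧ y))
        distrib = solve-∀ GF2
    forward : ∀ T → Dependency c T → Dependency d T
    forward T dep j = begin
      colSum d T j                             ≡⟨ colSum-d T j ⟩
      colSum c T j xor (a j ∧ colSum c T v)    ≡⟨ cong₂ (λ x y → x xor (a j ∧ y)) (dep j) (dep v) ⟩
      a j ∧ false                              ≡⟨ ∧-zeroʳ (a j) ⟩
      false                                    ∎
    -- the pivot row v is left unchanged
    pivotRow : ∀ T → Dependency d T → colSum c T v ≡ false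
    pivotRow T dep = begin
      colSum c T v                              ≡⟨ sym (xor-identityʳ _) ⟩
      colSum c T v xor false                    ≡⟨ cong (λ x → colSum c T v xor (x ∧ colSum c T v)) (sym av≡false) ⟩
      colSum c T v xor (a v ∧ colSum c T v)     ≡⟨ sym (colSum-d T v) ⟩
      colSum d T v                              ≡⟨ dep v ⟩
      false                                     ∎
    backward : ∀ T → Dependency d T → Dependency c T
    backward T dep j = begin
      colSum c T j                              ≡⟨ sym (xor-identityʳ _) ⟩
      colSum c T j xor false                    ≡⟨ cong (colSum c T j xor_) (sym (∧-zeroʳ (a j))) ⟩
      colSum c T j xor (a j ∧ false)            ≡⟨ cong (λ x → colSum c T j xor (a j ∧ x)) (sym (pivotRow T dep)) ⟩
      colSum c T j xor (a j ∧ colSum c T v)     ≡⟨ sym (colSum-d T j) ⟩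
      colSum d T j                              ≡⟨ dep j ⟩
      false                                     ∎

-- Contracting an element v whose column is the unit vector at row r amounts to
-- deleting the column v and the row r.
module UnitColumn {k n} (c : Columns (suc k) (suc n)) (v : Fin (suc k)) (r : Fin (suc n))
                  (unit : ∀ j → c v j ≡ (j == r)) where

  reduced : Columns k n
  reduced u j = c (punchIn v u) (punchIn r j)

  private
    cvr : c v r ≡ true
    cvr = trans (unit r) (==-refl r)

    cv-off : ∀ j → c v (punchIn r j) ≡ false
    cv-off j = trans (unit _) (punchIn==v r j)

  -- A dependency T' of the reduced columns extends to the dependency T' + b·v of c.
  extend : ∀ S → binaryMatroid c (extendAt v true S) → binaryMatroid reduced S
  extend S ind T' T'⊆S dep' u = begin
    T' u            ≡⟨ sym (extendAt-punchIn v b T' u) ⟩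
    T (punchIn v u) ≡⟨ ind T (extendAt-⊆ v b T'⊆S) dep (punchIn v u) ⟩
    false           ∎
    where
      b = colSum (c ∘ punchIn v) T' r
      T = extendAt v b T'
      dep : Dependency c T
      dep = punchIn-cases r _
        (begin
          colSum c T r                    ≡⟨ colSum-extendAt c v b T' r ⟩
          (b ∧ c v r) xor b               ≡⟨ cong (λ x → (b ∧ x) xor b) cvr ⟩
          (b ∧ true) xor b                ≡⟨ cong (_xor b) (∧-identityʳ b) ⟩
          b xor b                         ≡⟨ xor-same b ⟩
          false                           ∎)
        (λ j → begin
          colSum c T (punchIn r j)                        ≡⟨ colSum-extendAt c v b T' (punchIn r j) ⟩
          (b ∧ c v (punchIn r j)) xor colSum reduced T' j ≡⟨ cong (λ x → (b ∧ x) xor colSum reduced T' j) (cv-off j) ⟩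
          (b ∧ false) xor colSum reduced T' j             ≡⟨ cong (_xor colSum reduced T' j) (∧-zeroʳ b) ⟩
          colSum reduced T' j                             ≡⟨ dep' j ⟩
          false                                           ∎)

  -- A dependency T of c restricts to a dependency of the reduced columns, hence is
  -- empty off v; the row r then forces it to be empty.
  restrict : ∀ S → binaryMatroid reduced S → binaryMatroid c (extendAt v true S)
  restrict S ind T T⊆S dep = punchIn-cases v (λ i → T i ≡ false) Tv≡false T'≡false
    where
      T' = T ∘ punchIn v
      T'⊆S : T' ⊆ S
      T'⊆S u t = trans (sym (extendAt-punchIn v true S u)) (T⊆S (punchIn v u) t)
      dep' : Dependency reduced T'
      dep' j = begin
        colSum reduced T' j                                ≡⟨ cong (_xor colSum reduced T' j) (sym (∧-zeroʳ (T v))) ⟩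
        (T v ∧ false) xor colSum reduced T' j              ≡⟨ cong (λ x → (T v ∧ x) xor colSum reduced T' j) (sym (cv-off j)) ⟩
        (T v ∧ c v (punchIn r j)) xor colSum reduced T' j  ≡⟨ sym (colSum-split c v T (punchIn r j)) ⟩
        colSum c T (punchIn r j)                           ≡⟨ dep (punchIn r j) ⟩
        false                                              ∎
      T'≡false : ∀ u → T' u ≡ false
      T'≡false = ind T' T'⊆S dep'
      Tv≡false : T v ≡ false
      Tv≡false = begin
        T v                                             ≡⟨ sym (∧-identityʳ (T v)) ⟩
        T v ∧ true                                      ≡⟨ cong (T v ∧_) (sym cvr) ⟩
        T v ∧ c v r                                     ≡⟨ sym (xor-identityʳ _) ⟩
        (T v ∧ c v r) xor false                         ≡⟨ cong ((T v ∧ c v r) xor_) (sym (trans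
                                                             (xorSum-cong λ u → cong (_∧ c (punchIn v u) r) (T'≡false u))
                                                             (xorSum-zero {k}))) ⟩
        (T v ∧ c v r) xor colSum (c ∘ punchIn v) T' r   ≡⟨ sym (colSum-split c v T r) ⟩
        colSum c T r                                    ≡⟨ dep r ⟩
        false                                           ∎

  contract : ∀ S → binaryMatroid c (extendAt v true S) ⇔ binaryMatroid reduced S
  contract S = mk⇔ (extend S) (restrict S)

Spans : ∀ {k n} → Columns k n → (Fin n → Bool) → Set
Spans {k} c x = Σ (Subset k) λ R → ∀ j → colSum c R j ≡ x j

Spans-cong : ∀ {k n} {c d : Columns k n} {x y : Fin n → Bool}
           → (∀ i j → c i j ≡ d i j) → (∀ j → x j ≡ y j) → Spans c x → Spans d y
Spans-cong c≡d x≡y (R , sum) = R , λ j → trans (sym (colSum-cong c≡d R j)) (trans (sum j) (x≡y j))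

spans? : ∀ {k n} (c : Columns k n) x → Dec (Spans c x)
spans? c x = map′
  (λ (R , sum) → lookup R , sum)
  (λ (R , sum) → tabulate R , λ j → trans (xorSum-cong λ i → cong (_∧ c i j) (lookup∘tabulate R i)) (sum j))
  (anySubset? λ R → all? λ j → colSum c (lookup R) j ≟ᴮ x j)

coloop : ∀ {k n} (c : Columns (suc k) n) v → ¬ Spans (c ∘ punchIn v) (c v)
       → ∀ S → binaryMatroid c (extendAt v false S) ⇔ binaryMatroid c (extendAt v true S)
coloop c v notSpanned S = mk⇔ forward backward
  where
    backward : binaryMatroid c (extendAt v true S) → binaryMatroid c (extendAt v false S)
    backward ind T T⊆S = ind T (λ i t → extendAt-⊆ v false (λ _ s → s) i (T⊆S i t))
    forward : binaryMatroid c (extendAt v false S) → binaryMatroid c (extendAt v true S)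
    forward ind T T⊆S dep = ind T T⊆S' dep
      where
        -- otherwise the rest of T would express the column v
        Tv≡false : T v ≡ false
        Tv≡false = ¬-not λ Tv → notSpanned (T ∘ punchIn v , λ j → begin
          rest j              ≡⟨ xor-solve (c v j) (rest j) false (begin
              c v j xor rest j             ≡⟨ cong (λ x → (x ∧ c v j) xor rest j) (sym Tv) ⟩
              (T v ∧ c v j) xor rest j     ≡⟨ sym (colSum-split c v T j) ⟩
              colSum c T j                 ≡⟨ dep j ⟩
              false                        ∎) ⟩
          c v j xor false     ≡⟨ xor-identityʳ (c v j) ⟩
          c v j               ∎)
          where
            rest : _ → Bool
            rest = colSum (c ∘ punchIn v) (T ∘ punchIn v)
        T⊆S' : T ⊆ extendAt v false S
        T⊆S' = punchIn-cases v (λ i → T i ≡ true → extendAt v false S i ≡ true)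
          (λ Tv → case trans (sym Tv) Tv≡false of λ ())
          (λ u t → trans (extendAt-punchIn v false S u) (trans (sym (extendAt-punchIn v true S u)) (T⊆S (punchIn v u) t)))

nonzero-independent : ∀ {k n} (c : Columns (suc k) n) v j → c v j ≡ true → binaryMatroid c (singleton v)
nonzero-independent c v j cvj T T⊆v dep = punchIn-cases v (λ i → T i ≡ false) Tv≡false Tu≡false
  where
    Tu≡false : ∀ u → T (punchIn v u) ≡ false
    Tu≡false u = ¬-not λ t → case trans (sym (T⊆v (punchIn v u) t)) (punchIn==v v u) of λ ()
    Tv≡false : T v ≡ false
    Tv≡false = begin
      T v             ≡⟨ sym (∧-identityʳ (T v)) ⟩
      T v ∧ true      ≡⟨ cong (T v ∧_) (sym cvj) ⟩
      T v ∧ c v j     ≡⟨ sym (xorSum-point v (λ i → T i ∧ c i j) λ u → cong (_∧ c (punchIn v u) j) (Tu≡false u)) ⟩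
      colSum c T j    ≡⟨ dep j ⟩
      false           ∎

zero-dependent : ∀ {k n} (c : Columns (suc k) n) v → (∀ j → c v j ≡ false) → ¬ binaryMatroid c (singleton v)
zero-dependent c v c≡0 ind = case trans (sym (==-refl v)) (ind (singleton v) (λ _ t → t) dep v) of λ ()
  where
    dep : Dependency c (singleton v)
    dep j = begin
      colSum c (singleton v) j   ≡⟨ xorSum-point v (λ i → (i == v) ∧ c i j) (λ u → cong (_∧ c (punchIn v u) j) (punchIn==v v u)) ⟩
      (v == v) ∧ c v j           ≡⟨ cong ((v == v) ∧_) (c≡0 j) ⟩
      (v == v) ∧ false           ≡⟨ ∧-zeroʳ (v == v) ⟩
      false                      ∎

-- Columns of IAS(B) and the transverse matroids

-- The entry of a column of IAS(B) labelled ℓ, from the entries e of I and x of A(B).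
iasEntry : Label → Bool → Bool → Bool
iasEntry φ e x = e
iasEntry χ e x = x
iasEntry ψ e x = x xor e

iasColumn-entry : ∀ {n} (B : Mat n) ℓ v j → iasColumn B ℓ v j ≡ iasEntry ℓ (j == v) (B j v)
iasColumn-entry B φ v j = refl
iasColumn-entry B χ v j = refl
iasColumn-entry B ψ v j = refl

col : ∀ {n} → Mat n → Transversal n → Columns n n
col B τ v = iasColumn B (τ v) v

relabel : ∀ {n} → Transversal n → Fin n → Label → Transversal n
relabel τ w ℓ u = if u == w then ℓ else τ u

relabel-at : ∀ {n} (τ : Transversal n) w ℓ → relabel τ w ℓ w ≡ ℓ
relabel-at τ w ℓ rewrite ==-refl w = refl

relabel-off : ∀ {n} (τ : Transversal n) w ℓ u → ¬ u ≡ w → relabel τ w ℓ u ≡ τ u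
relabel-off τ w ℓ u u≢w rewrite ==-no u≢w = refl

nbr-self : ∀ {n} (B : Mat n) w → nbr B w w ≡ false
nbr-self B w = trans (cong (λ e → B w w ∧ not e) (==-refl w)) (∧-zeroʳ (B w w))

nbr-distinct : ∀ {n} (B : Mat n) w u → ¬ u ≡ w → nbr B w u ≡ B w u
nbr-distinct B w u u≢w = trans (cong (λ e → B w u ∧ not e) (==-no u≢w)) (∧-identityʳ (B w u))

-- The new label of w under local complementation at w (b is the loop status of w),
-- and under loop complementation at w.
nsLabel : Bool → Label → Label
nsLabel false φ = ψ
nsLabel false χ = χ
nsLabel false ψ = φ
nsLabel true  φ = χ
nsLabel true  χ = φ
nsLabel true  ψ = ψ

loopLabel : Label → Label
loopLabel φ = φ
loopLabel χ = ψ
loopLabel ψ = χ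

nsLabel-diagonal : ∀ b ℓ → iasEntry (nsLabel b ℓ) true b ≡ iasEntry ℓ true b
nsLabel-diagonal false φ = refl
nsLabel-diagonal false χ = refl
nsLabel-diagonal false ψ = refl
nsLabel-diagonal true  φ = refl
nsLabel-diagonal true  χ = refl
nsLabel-diagonal true  ψ = refl

nsLabel-offDiagonal : ∀ b ℓ x → iasEntry (nsLabel b ℓ) false x ≡ iasEntry ℓ false x xor (x ∧ iasEntry ℓ true b)
nsLabel-offDiagonal false φ false = refl
nsLabel-offDiagonal false φ true  = refl
nsLabel-offDiagonal false χ false = refl
nsLabel-offDiagonal false χ true  = refl
nsLabel-offDiagonal false ψ false = refl
nsLabel-offDiagonal false ψ true  = refl
nsLabel-offDiagonal true  φ false = refl
nsLabel-offDiagonal true  φ true  = refl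
nsLabel-offDiagonal true  χ false = refl
nsLabel-offDiagonal true  χ true  = refl
nsLabel-offDiagonal true  ψ false = refl
nsLabel-offDiagonal true  ψ true  = refl

-- Entry (j, w) of the pivot column: x = B j w, e = [j = w], b = B w w.
nsLabel-entry : ∀ b ℓ e x → (e ≡ true → x ≡ b)
              → iasEntry (nsLabel b ℓ) e x ≡ iasEntry ℓ e x xor ((x ∧ not e) ∧ iasEntry ℓ true b)
nsLabel-entry b ℓ true x x≡b rewrite x≡b refl | ∧-zeroʳ b = trans (nsLabel-diagonal b ℓ) (sym (xor-identityʳ _))
nsLabel-entry b ℓ false x _ rewrite ∧-identityʳ x = nsLabel-offDiagonal b ℓ x

iasEntry-shift : ∀ ℓ e x n y → iasEntry ℓ e (x xor (n ∧ y)) ≡ iasEntry ℓ e x xor (n ∧ iasEntry ℓ false y)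
iasEntry-shift φ e x n y = sym (trans (cong (e xor_) (∧-zeroʳ n)) (xor-identityʳ e))
iasEntry-shift χ e x n y = refl
iasEntry-shift ψ e x n y = trans (shift x e n y) (cong (λ z → (x xor e) xor (n ∧ z)) (sym (xor-identityʳ y)))
  where
    shift : ∀ x e n y → (x xor (n ∧ y)) xor e ≡ (x xor e) xor (n ∧ y)
    shift = solve-∀ GF2

-- Loop complementation at w adds the diagonal entry e to the A-part of column w;
-- loopLabel compensates.
loopLabel-entry : ∀ ℓ e x → iasEntry (loopLabel ℓ) e (x xor e) ≡ iasEntry ℓ e x
loopLabel-entry φ e x = refl
loopLabel-entry χ e x = cancel x e
  where
    cancel : ∀ x e → (x xor e) xor e ≡ x
    cancel = solve-∀ GF2
loopLabel-entry ψ e x = refl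

-- Local complementation at w adds nbr(w, j) times row w to each row j of the
-- transverse columns, once the label of w is changed by nsLabel.
nsComp-pivotColumn : ∀ {n} (B : Mat n) → SymmetricMat B → (τ : Transversal n) → ∀ w j
                   → col (nsComp B w) (relabel τ w (nsLabel (B w w) (τ w))) w j ≡ col B τ w j xor (nbr B w j ∧ col B τ w w)
nsComp-pivotColumn B sym-B τ w j = begin
  iasColumn (nsComp B w) (relabel τ w ℓ' w) w j
    ≡⟨ cong (λ l → iasColumn (nsComp B w) l w j) (relabel-at τ w ℓ') ⟩
  iasColumn (nsComp B w) ℓ' w j
    ≡⟨ iasColumn-entry (nsComp B w) ℓ' w j ⟩
  iasEntry ℓ' (j == w) (B j w xor (nbr B w j ∧ nbr B w w))
    ≡⟨ cong (λ y → iasEntry ℓ' (j == w) (B j w xor y)) (trans (cong (nbr B w j ∧_) (nbr-self B w)) (∧-zeroʳ _)) ⟩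
  iasEntry ℓ' (j == w) (B j w xor false)
    ≡⟨ cong (iasEntry ℓ' (j == w)) (xor-identityʳ (B j w)) ⟩
  iasEntry ℓ' (j == w) (B j w)
    ≡⟨ nsLabel-entry (B w w) (τ w) (j == w) (B j w) (λ j==w → cong (λ i → B i w) (==⇒≡ j==w)) ⟩
  iasEntry (τ w) (j == w) (B j w) xor ((B j w ∧ not (j == w)) ∧ iasEntry (τ w) true (B w w))
    ≡⟨ sym (cong₂ (λ p q → p xor (q ∧ iasEntry (τ w) true (B w w)))
                  (iasColumn-entry B (τ w) w j) (cong (λ x → x ∧ not (j == w)) (sym-B w j))) ⟩
  col B τ w j xor (nbr B w j ∧ iasEntry (τ w) true (B w w))
    ≡⟨ cong (λ e → col B τ w j xor (nbr B w j ∧ iasEntry (τ w) e (B w w))) (sym (==-refl w)) ⟩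
  col B τ w j xor (nbr B w j ∧ iasEntry (τ w) (w == w) (B w w))
    ≡⟨ cong (λ x → col B τ w j xor (nbr B w j ∧ x)) (sym (iasColumn-entry B (τ w) w w)) ⟩
  col B τ w j xor (nbr B w j ∧ col B τ w w) ∎
  where ℓ' = nsLabel (B w w) (τ w)

nsComp-otherColumn : ∀ {n} (B : Mat n) (τ : Transversal n) w u j → ¬ u ≡ w
                   → col (nsComp B w) (relabel τ w (nsLabel (B w w) (τ w))) u j ≡ col B τ u j xor (nbr B w j ∧ col B τ u w)
nsComp-otherColumn B τ w u j u≢w = begin
  iasColumn (nsComp B w) (relabel τ w ℓ' u) u j
    ≡⟨ cong (λ l → iasColumn (nsComp B w) l u j) (relabel-off τ w ℓ' u u≢w) ⟩
  iasColumn (nsComp B w) (τ u) u j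
    ≡⟨ iasColumn-entry (nsComp B w) (τ u) u j ⟩
  iasEntry (τ u) (j == u) (B j u xor (nbr B w j ∧ nbr B w u))
    ≡⟨ cong (λ y → iasEntry (τ u) (j == u) (B j u xor (nbr B w j ∧ y))) (nbr-distinct B w u u≢w) ⟩
  iasEntry (τ u) (j == u) (B j u xor (nbr B w j ∧ B w u))
    ≡⟨ iasEntry-shift (τ u) (j == u) (B j u) (nbr B w j) (B w u) ⟩
  iasEntry (τ u) (j == u) (B j u) xor (nbr B w j ∧ iasEntry (τ u) false (B w u))
    ≡⟨ sym (cong₂ (λ p q → p xor (nbr B w j ∧ q)) (iasColumn-entry B (τ u) u j)
                  (trans (iasColumn-entry B (τ u) u w) (cong (λ e → iasEntry (τ u) e (B w u)) (==-no (u≢w ∘ sym))))) ⟩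
  col B τ u j xor (nbr B w j ∧ col B τ u w) ∎
  where ℓ' = nsLabel (B w w) (τ w)

nsComp-columns : ∀ {n} (B : Mat n) → SymmetricMat B → (τ : Transversal n) → ∀ w u j
               → col (nsComp B w) (relabel τ w (nsLabel (B w w) (τ w))) u j ≡ col B τ u j xor (nbr B w j ∧ col B τ u w)
nsComp-columns B sym-B τ w u j = case u ≟ w of λ
  { (yes refl) → nsComp-pivotColumn B sym-B τ u j
  ; (no u≢w)   → nsComp-otherColumn B τ w u j u≢w }

loopComp-pivotColumn : ∀ {n} (B : Mat n) (τ : Transversal n) w j
                     → col (loopComp B w) (relabel τ w (loopLabel (τ w))) w j ≡ col B τ w j
loopComp-pivotColumn B τ w j = begin
  iasColumn (loopComp B w) (relabel τ w (loopLabel (τ w)) w) w j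
    ≡⟨ cong (λ l → iasColumn (loopComp B w) l w j) (relabel-at τ w _) ⟩
  iasColumn (loopComp B w) (loopLabel (τ w)) w j
    ≡⟨ iasColumn-entry (loopComp B w) (loopLabel (τ w)) w j ⟩
  iasEntry (loopLabel (τ w)) (j == w) (B j w xor ((j == w) ∧ (w == w)))
    ≡⟨ cong (λ e → iasEntry (loopLabel (τ w)) (j == w) (B j w xor ((j == w) ∧ e))) (==-refl w) ⟩
  iasEntry (loopLabel (τ w)) (j == w) (B j w xor ((j == w) ∧ true))
    ≡⟨ cong (λ e → iasEntry (loopLabel (τ w)) (j == w) (B j w xor e)) (∧-identityʳ (j == w)) ⟩
  iasEntry (loopLabel (τ w)) (j == w) (B j w xor (j == w))
    ≡⟨ loopLabel-entry (τ w) (j == w) (B j w) ⟩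
  iasEntry (τ w) (j == w) (B j w)
    ≡⟨ sym (iasColumn-entry B (τ w) w j) ⟩
  col B τ w j ∎

loopComp-otherColumn : ∀ {n} (B : Mat n) (τ : Transversal n) w u j → ¬ u ≡ w
                     → col (loopComp B w) (relabel τ w (loopLabel (τ w))) u j ≡ col B τ u j
loopComp-otherColumn B τ w u j u≢w = begin
  iasColumn (loopComp B w) (relabel τ w (loopLabel (τ w)) u) u j
    ≡⟨ cong (λ l → iasColumn (loopComp B w) l u j) (relabel-off τ w _ u u≢w) ⟩
  iasColumn (loopComp B w) (τ u) u j
    ≡⟨ iasColumn-entry (loopComp B w) (τ u) u j ⟩
  iasEntry (τ u) (j == u) (B j u xor ((j == w) ∧ (u == w)))
    ≡⟨ cong (λ e → iasEntry (τ u) (j == u) (B j u xor ((j == w) ∧ e))) (==-no u≢w) ⟩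
  iasEntry (τ u) (j == u) (B j u xor ((j == w) ∧ false))
    ≡⟨ cong (λ e → iasEntry (τ u) (j == u) (B j u xor e)) (∧-zeroʳ (j == w)) ⟩
  iasEntry (τ u) (j == u) (B j u xor false)
    ≡⟨ cong (iasEntry (τ u) (j == u)) (xor-identityʳ (B j u)) ⟩
  iasEntry (τ u) (j == u) (B j u)
    ≡⟨ sym (iasColumn-entry B (τ u) u j) ⟩
  col B τ u j ∎

loopComp-columns : ∀ {n} (B : Mat n) (τ : Transversal n) w u j
                 → col (loopComp B w) (relabel τ w (loopLabel (τ w))) u j ≡ col B τ u j
loopComp-columns B τ w u j = case u ≟ w of λ
  { (yes refl) → loopComp-pivotColumn B τ u j
  ; (no u≢w)   → loopComp-otherColumn B τ w u j u≢w }

ns-preserves : ∀ {n} (B : Mat n) → SymmetricMat B → (τ : Transversal n) → ∀ w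
             → transverseMatroid B τ ≈M transverseMatroid (nsComp B w) (relabel τ w (nsLabel (B w w) (τ w)))
ns-preserves B sym-B τ w = rowOperation (col B τ) _ (nbr B w) w (nbr-self B w) (nsComp-columns B sym-B τ w)

loop-preserves : ∀ {n} (B : Mat n) (τ : Transversal n) w
               → transverseMatroid B τ ≈M transverseMatroid (loopComp B w) (relabel τ w (loopLabel (τ w)))
loop-preserves B τ w = sameColumns (col B τ) _ (λ u j → sym (loopComp-columns B τ w u j))

contract-φ : ∀ {m} (B : Mat (suc m)) (τ : Transversal (suc m)) v → τ v ≡ φ
           → ∀ S → transverseMatroid B τ (extendAt v true S) ⇔ transverseMatroid (delV B v) (τ ∘ punchIn v) S
contract-φ B τ v τv≡φ S =
  sameColumns _ (col (delV B v) (τ ∘ punchIn v)) deleted S ⇔-∘ UnitColumn.contract (col B τ) v v unit S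
  where
    unit : ∀ j → col B τ v j ≡ (j == v)
    unit j = cong (λ l → iasColumn B l v j) τv≡φ
    deleted : ∀ u j → col B τ (punchIn v u) (punchIn v j) ≡ col (delV B v) (τ ∘ punchIn v) u j
    deleted u j = begin
      col B τ (punchIn v u) (punchIn v j)
        ≡⟨ iasColumn-entry B (τ (punchIn v u)) (punchIn v u) (punchIn v j) ⟩
      iasEntry (τ (punchIn v u)) (punchIn v j == punchIn v u) (B (punchIn v j) (punchIn v u))
        ≡⟨ cong (λ e → iasEntry (τ (punchIn v u)) e (B (punchIn v j) (punchIn v u))) (punchIn-== v j u) ⟩
      iasEntry (τ (punchIn v u)) (j == u) (delV B v j u)
        ≡⟨ sym (iasColumn-entry (delV B v) (τ (punchIn v u)) u j) ⟩
      col (delV B v) (τ ∘ punchIn v) u j ∎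

φ-independent : ∀ {m} (B : Mat (suc m)) (τ : Transversal (suc m)) v → τ v ≡ φ → transverseMatroid B τ (singleton v)
φ-independent B τ v τv≡φ = nonzero-independent (col B τ) v v (trans (cong (λ l → iasColumn B l v v) τv≡φ) (==-refl v))

loopComp-symmetric : ∀ {n} (B : Mat n) → SymmetricMat B → ∀ w → SymmetricMat (loopComp B w)
loopComp-symmetric B sym-B w i j = cong₂ _xor_ (sym-B i j) (∧-comm (i == w) (j == w))

nsComp-symmetric : ∀ {n} (B : Mat n) → SymmetricMat B → ∀ w → SymmetricMat (nsComp B w)
nsComp-symmetric B sym-B w i j = cong₂ _xor_ (sym-B i j) (∧-comm (nbr B w i) (nbr B w j))

delV-symmetric : ∀ {n} (B : Mat (suc n)) → SymmetricMat B → ∀ w → SymmetricMat (delV B w)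
delV-symmetric B sym-B w i j = sym-B (punchIn w i) (punchIn w j)

vm-trans : ∀ {n m k} {A : Mat n} {B : Mat m} {C : Mat k} → VertexMinor A B → VertexMinor B C → VertexMinor A C
vm-trans A≥B vm-refl        = A≥B
vm-trans A≥B (vm-loop B≥C v) = vm-loop (vm-trans A≥B B≥C) v
vm-trans A≥B (vm-s B≥C v)    = vm-s (vm-trans A≥B B≥C) v
vm-trans A≥B (vm-ns B≥C v)   = vm-ns (vm-trans A≥B B≥C) v
vm-trans A≥B (vm-del B≥C v)  = vm-del (vm-trans A≥B B≥C) v

-- The key lemma: φ(v) and χ(v) are not both spanned by the other elements

_·_ : ∀ {n} → (Fin n → Bool) → (Fin n → Bool) → Bool
x · y = xorSum (λ i → x i ∧ y i)

_*ᵥ_ : ∀ {n} → Mat n → (Fin n → Bool) → Fin n → Bool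
(B *ᵥ y) j = xorSum (λ i → B j i ∧ y i)

·-xor : ∀ {n} (x y z : Fin n → Bool) → x · (λ j → y j xor z j) ≡ (x · y) xor (x · z)
·-xor x y z = trans (xorSum-cong λ i → ∧-distribˡ-xor (x i) (y i) (z i)) (xorSum-xor (λ i → x i ∧ y i) (λ i → x i ∧ z i))

·-unit : ∀ {n} (x : Fin (suc n) → Bool) v → x · (λ j → j == v) ≡ x v
·-unit x v = begin
  x · (λ j → j == v)   ≡⟨ xorSum-point v (λ j → x j ∧ (j == v)) (λ u → trans (cong (x (punchIn v u) ∧_) (punchIn==v v u)) (∧-zeroʳ _)) ⟩
  x v ∧ (v == v)       ≡⟨ cong (x v ∧_) (==-refl v) ⟩
  x v ∧ true           ≡⟨ ∧-identityʳ (x v) ⟩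
  x v                  ∎

symmetric-form : ∀ {n} (B : Mat n) → SymmetricMat B → ∀ x y → x · (B *ᵥ y) ≡ y · (B *ᵥ x)
symmetric-form B sym-B x y = begin
  xorSum (λ j → x j ∧ xorSum (λ i → B j i ∧ y i))     ≡⟨ xorSum-cong (λ j → sym (xorSum-scale (x j) (λ i → B j i ∧ y i))) ⟩
  xorSum (λ j → xorSum (λ i → x j ∧ (B j i ∧ y i)))   ≡⟨ xorSum-swap (λ j i → x j ∧ (B j i ∧ y i)) ⟩
  xorSum (λ i → xorSum (λ j → x j ∧ (B j i ∧ y i)))   ≡⟨ xorSum-cong (λ i → xorSum-cong λ j → reorder (x j) (B j i) (B i j) (y i) (sym-B j i)) ⟩
  xorSum (λ i → xorSum (λ j → y i ∧ (B i j ∧ x j)))   ≡⟨ xorSum-cong (λ i → xorSum-scale (y i) (λ j → B i j ∧ x j)) ⟩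
  xorSum (λ i → y i ∧ xorSum (λ j → B i j ∧ x j))     ∎
  where
    reorder : ∀ a b b' c → b ≡ b' → a ∧ (b ∧ c) ≡ c ∧ (b' ∧ a)
    reorder a b .b c refl = comm a b c
      where
        comm : ∀ a b c → a ∧ (b ∧ c) ≡ c ∧ (b ∧ a)
        comm = solve-∀ GF2

-- A column of IAS is α times a unit vector plus β times a column of A.
α β : Label → Bool
α φ = true
α χ = false
α ψ = true
β φ = false
β χ = true
β ψ = true

iasEntry-linear : ∀ ℓ e x → iasEntry ℓ e x ≡ (α ℓ ∧ e) xor (β ℓ ∧ x)
iasEntry-linear φ e x = sym (xor-identityʳ e)
iasEntry-linear χ e x = refl
iasEntry-linear ψ e x = xor-comm x e

module TransverseSum {n} (B : Mat (suc n)) (τ : Transversal (suc n)) (R : Subset (suc n)) where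
  s t : Fin (suc n) → Bool
  s i = R i ∧ α (τ i)
  t i = R i ∧ β (τ i)

  colSum-col : ∀ j → colSum (col B τ) R j ≡ s j xor (B *ᵥ t) j
  colSum-col j = begin
    xorSum (λ i → R i ∧ col B τ i j)
      ≡⟨ xorSum-cong (λ i → cong (R i ∧_) (trans (iasColumn-entry B (τ i) i j) (iasEntry-linear (τ i) (j == i) (B j i)))) ⟩
    xorSum (λ i → R i ∧ ((α (τ i) ∧ (j == i)) xor (β (τ i) ∧ B j i)))
      ≡⟨ xorSum-cong (λ i → split (R i) (α (τ i)) (j == i) (β (τ i)) (B j i)) ⟩
    xorSum (λ i → (s i ∧ (j == i)) xor (B j i ∧ t i))
      ≡⟨ xorSum-xor (λ i → s i ∧ (j == i)) (λ i → B j i ∧ t i) ⟩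
    xorSum (λ i → s i ∧ (j == i)) xor (B *ᵥ t) j
      ≡⟨ cong (_xor (B *ᵥ t) j) (xorSum-point j (λ i → s i ∧ (j == i)) (λ u → trans (cong (s (punchIn j u) ∧_) (v==punchIn j u)) (∧-zeroʳ _))) ⟩
    (s j ∧ (j == j)) xor (B *ᵥ t) j
      ≡⟨ cong (λ e → (s j ∧ e) xor (B *ᵥ t) j) (==-refl j) ⟩
    (s j ∧ true) xor (B *ᵥ t) j
      ≡⟨ cong (_xor (B *ᵥ t) j) (∧-identityʳ (s j)) ⟩
    s j xor (B *ᵥ t) j ∎
    where
      split : ∀ r a e b x → r ∧ ((a ∧ e) xor (b ∧ x)) ≡ ((r ∧ a) ∧ e) xor (x ∧ (r ∧ b))
      split = solve-∀ GF2

spanned-avoiding : ∀ {k n} (c : Columns (suc k) n) v x → Spans (c ∘ punchIn v) x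
                 → Σ (Subset (suc k)) λ R → R v ≡ false × (∀ j → colSum c R j ≡ x j)
spanned-avoiding c v x (R , sum) = extendAt v false R , extendAt-at v false R , λ j → trans (colSum-extendAt c v false R j) (sum j)

φχ-not-both-spanned : ∀ {m} (B : Mat (suc m)) → SymmetricMat B → (τ : Transversal (suc m)) → ∀ v
                    → Spans (col B τ ∘ punchIn v) (λ j → j == v) → ¬ Spans (col B τ ∘ punchIn v) (λ j → B j v)
φχ-not-both-spanned B sym-B τ v spanφ spanχ
  with spanned-avoiding (col B τ) v _ spanφ | spanned-avoiding (col B τ) v _ spanχ
... | R , Rv≡false , sumR | R' , R'v≡false , sumR' = case trans (sym X≡true) X≡false of λ ()
  where
    open TransverseSum B τ R using (s; t; colSum-col)
    open TransverseSum B τ R' using () renaming (s to s'; t to t'; colSum-col to colSum-col')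
    Bt : ∀ j → (B *ᵥ t) j ≡ s j xor (j == v)
    Bt j = xor-solve (s j) _ _ (trans (sym (colSum-col j)) (sumR j))
    Bt' : ∀ j → B j v ≡ s' j xor (B *ᵥ t') j
    Bt' j = trans (sym (sumR' j)) (colSum-col' j)
    sv≡false : s v ≡ false
    sv≡false = cong (_∧ α (τ v)) Rv≡false
    t'v≡false : t' v ≡ false
    t'v≡false = cong (_∧ β (τ v)) R'v≡false
    -- X = t · χ(v) is computed in two ways
    X = t · (λ j → B j v)
    X≡true : X ≡ true
    X≡true = begin
      xorSum (λ j → t j ∧ B j v)   ≡⟨ xorSum-cong (λ j → trans (∧-comm (t j) (B j v)) (cong (_∧ t j) (sym-B j v))) ⟩
      (B *ᵥ t) v                   ≡⟨ Bt v ⟩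
      s v xor (v == v)             ≡⟨ cong₂ _xor_ sv≡false (==-refl v) ⟩
      true                         ∎
    X≡false : X ≡ false
    X≡false = begin
      t · (λ j → B j v)                                 ≡⟨ xorSum-cong (λ j → cong (t j ∧_) (Bt' j)) ⟩
      t · (λ j → s' j xor (B *ᵥ t') j)                  ≡⟨ ·-xor t s' (B *ᵥ t') ⟩
      (t · s') xor (t · (B *ᵥ t'))                      ≡⟨ cong ((t · s') xor_) (symmetric-form B sym-B t t') ⟩
      (t · s') xor (t' · (B *ᵥ t))                      ≡⟨ cong ((t · s') xor_) (xorSum-cong λ j → cong (t' j ∧_) (Bt j)) ⟩
      (t · s') xor (t' · (λ j → s j xor (j == v)))      ≡⟨ cong ((t · s') xor_) (·-xor t' s (λ j → j == v)) ⟩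
      (t · s') xor ((t' · s) xor (t' · (λ j → j == v))) ≡⟨ cong (λ y → (t · s') xor ((t' · s) xor y)) (trans (·-unit t' v) t'v≡false) ⟩
      (t · s') xor ((t' · s) xor false)                 ≡⟨ cong ((t · s') xor_) (xor-identityʳ (t' · s)) ⟩
      (t · s') xor (t' · s)                             ≡⟨ cong ((t · s') xor_) (xorSum-cong λ i → swap (R' i) (β (τ i)) (R i) (α (τ i))) ⟩
      (t · s') xor (t · s')                             ≡⟨ xor-same (t · s') ⟩
      false                                             ∎
      where
        swap : ∀ r b r' a → (r ∧ b) ∧ (r' ∧ a) ≡ (r' ∧ b) ∧ (r ∧ a)
        swap = solve-∀ GF2

-- Moving the label of a vertex to φ

φAt : ∀ {n} → Mat n → Transversal n → Fin n → Set
φAt {n} B τ v = Σ (Mat n) λ B' → VertexMinor B B' × SymmetricMat B'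
              × Σ (Transversal n) λ τ' → τ' v ≡ φ × transverseMatroid B τ ≈M transverseMatroid B' τ'

φAt-here : ∀ {n} (B : Mat n) → SymmetricMat B → (τ : Transversal n) → ∀ v → τ v ≡ φ → φAt B τ v
φAt-here B sym-B τ v τv≡φ = B , vm-refl , sym-B , τ , τv≡φ , ≈M-refl

φAt-after-ns : ∀ {n} (B : Mat n) → SymmetricMat B → (τ : Transversal n) → ∀ w v
             → φAt (nsComp B w) (relabel τ w (nsLabel (B w w) (τ w))) v → φAt B τ v
φAt-after-ns B sym-B τ w v (B' , B≥B' , sym' , τ' , τ'v≡φ , same) =
  B' , vm-trans (vm-ns vm-refl w) B≥B' , sym' , τ' , τ'v≡φ , ≈M-trans (ns-preserves B sym-B τ w) same

φAt-after-loop : ∀ {n} (B : Mat n) (τ : Transversal n) w v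
               → φAt (loopComp B w) (relabel τ w (loopLabel (τ w))) v → φAt B τ v
φAt-after-loop B τ w v (B' , B≥B' , sym' , τ' , τ'v≡φ , same) =
  B' , vm-trans (vm-loop vm-refl w) B≥B' , sym' , τ' , τ'v≡φ , ≈M-trans (loop-preserves B τ w) same

φAt-by-ns : ∀ {n} (B : Mat n) → SymmetricMat B → (τ : Transversal n) → ∀ v → nsLabel (B v v) (τ v) ≡ φ → φAt B τ v
φAt-by-ns B sym-B τ v becomesφ = φAt-after-ns B sym-B τ v v
  (φAt-here (nsComp B v) (nsComp-symmetric B sym-B v) (relabel τ v (nsLabel (B v v) (τ v))) v (trans (relabel-at τ v _) becomesφ))

nbr-irreflexive : ∀ {n} (B : Mat n) v w → nbr B v w ≡ true → ¬ w ≡ v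
nbr-irreflexive B v .v vv refl = case trans (sym vv) (nbr-self B v) of λ ()

-- An unlooped vertex v labelled χ with a neighbour w: local complementation at w
-- puts a loop at v, and then local complementation at v gives v the label φ.
φAt-via-neighbour : ∀ {n} (B : Mat n) → SymmetricMat B → (τ : Transversal n) → ∀ v w
                  → B v v ≡ false → τ v ≡ χ → nbr B v w ≡ true → φAt B τ v
φAt-via-neighbour B sym-B τ v w unlooped τv≡χ vw = φAt-after-ns B sym-B τ w v
  (φAt-by-ns (nsComp B w) (nsComp-symmetric B sym-B w) (relabel τ w (nsLabel (B w w) (τ w))) v (cong₂ nsLabel looped label))
  where
    v≢w : ¬ v ≡ w
    v≢w v≡w = nbr-irreflexive B v w vw (sym v≡w)
    wv : nbr B w v ≡ true
    wv = begin
      nbr B w v   ≡⟨ nbr-distinct B w v v≢w ⟩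
      B w v       ≡⟨ sym-B w v ⟩
      B v w       ≡⟨ sym (nbr-distinct B v w (v≢w ∘ sym)) ⟩
      nbr B v w   ≡⟨ vw ⟩
      true        ∎
    looped : nsComp B w v v ≡ true
    looped = cong₂ (λ x y → x xor (y ∧ y)) unlooped wv
    label : relabel τ w (nsLabel (B w w) (τ w)) v ≡ χ
    label = trans (relabel-off τ w _ v v≢w) τv≡χ

neighbour-or-isolated : ∀ {n} (B : Mat n) v → (Σ (Fin n) λ w → nbr B v w ≡ true) ⊎ (∀ w → nbr B v w ≡ false)
neighbour-or-isolated B v with any? (λ w → nbr B v w ≟ᴮ true)
... | yes neighbour = inj₁ neighbour
... | no none       = inj₂ λ w → ¬-not λ vw → none (w , vw)

isolated-column : ∀ {n} (B : Mat n) → SymmetricMat B → ∀ v → (∀ w → nbr B v w ≡ false) → ∀ j → B j v ≡ (j == v) ∧ B v v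
isolated-column B sym-B v isolated j with j ≟ v
... | yes refl = refl
... | no j≢v   = trans (sym-B j v) (trans (sym (nbr-distinct B v j j≢v)) (isolated j))

loopComp-offDiagonal : ∀ {n} (B : Mat n) v u w → ¬ w ≡ v → loopComp B v u w ≡ B u w
loopComp-offDiagonal B v u w w≢v =
  trans (cong (λ e → B u w xor ((u == v) ∧ e)) (==-no w≢v)) (trans (cong (B u w xor_) (∧-zeroʳ (u == v))) (xor-identityʳ (B u w)))

makeφ : ∀ {n} (B : Mat n) → SymmetricMat B → (τ : Transversal n) → ∀ v → ¬ (∀ j → col B τ v j ≡ false) → φAt B τ v
makeφ B sym-B τ v nonzero with τ v in τv | B v v in loopv
... | φ | _     = φAt-here B sym-B τ v τv
... | χ | true  = φAt-by-ns B sym-B τ v (cong₂ nsLabel loopv τv)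
... | ψ | false = φAt-by-ns B sym-B τ v (cong₂ nsLabel loopv τv)
... | χ | false = case neighbour-or-isolated B v of λ
  { (inj₁ (w , vw)) → φAt-via-neighbour B sym-B τ v w loopv τv vw
  ; (inj₂ isolated) → ⊥-elim (nonzero λ j → begin
      B j v                   ≡⟨ isolated-column B sym-B v isolated j ⟩
      (j == v) ∧ B v v        ≡⟨ cong ((j == v) ∧_) loopv ⟩
      (j == v) ∧ false        ≡⟨ ∧-zeroʳ (j == v) ⟩
      false                   ∎) }
-- a looped ψ-vertex becomes an unlooped χ-vertex after loop complementation
... | ψ | true = case neighbour-or-isolated B v of λ
  { (inj₁ (w , vw)) → φAt-after-loop B τ v v (φAt-via-neighbour (loopComp B v) (loopComp-symmetric B sym-B v) (relabel τ v (loopLabel (τ v))) v w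
       (cong₂ (λ x e → x xor (e ∧ e)) loopv (==-refl v))
       (trans (relabel-at τ v _) (cong loopLabel τv))
       (trans (cong (λ x → x ∧ not (w == v)) (loopComp-offDiagonal B v v w (nbr-irreflexive B v w vw))) vw))
  ; (inj₂ isolated) → ⊥-elim (nonzero λ j → begin
      B j v xor (j == v)             ≡⟨ cong (_xor (j == v)) (isolated-column B sym-B v isolated j) ⟩
      ((j == v) ∧ B v v) xor (j == v) ≡⟨ cong (λ x → ((j == v) ∧ x) xor (j == v)) loopv ⟩
      ((j == v) ∧ true) xor (j == v) ≡⟨ cong (_xor (j == v)) (∧-identityʳ (j == v)) ⟩
      (j == v) xor (j == v)          ≡⟨ xor-same (j == v) ⟩
      false                          ∎) }

-- Deletion and contraction

Realised : ∀ {n m} → Mat n → Matroid m → Set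
Realised {m = m} A N = Σ (Mat m) λ B → VertexMinor A B × SymmetricMat B
                     × Σ (Transversal m) λ τ → N ≈M transverseMatroid B τ

Realised-cong : ∀ {n m} {A : Mat n} {N N' : Matroid m} → N ≈M N' → Realised A N' → Realised A N
Realised-cong N≈N' (B , A≥B , sym-B , τ , same) = B , A≥B , sym-B , τ , ≈M-trans N≈N' same

Realised-via : ∀ {n m k} {A : Mat n} {B : Mat m} {N : Matroid k} → VertexMinor A B → Realised B N → Realised A N
Realised-via A≥B (C , B≥C , sym-C , τ , same) = C , vm-trans A≥B B≥C , sym-C , τ , same

φAt-extend : ∀ {m} (B : Mat (suc m)) (τ : Transversal (suc m)) v
           → φAt B τ v → Realised B (λ S → transverseMatroid B τ (extendAt v true S))
φAt-extend B τ v (B' , B≥B' , sym' , τ' , τ'v≡φ , same) =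
  delV B' v , vm-del B≥B' v , delV-symmetric B' sym' v , τ' ∘ punchIn v ,
  λ S → contract-φ B' τ' v τ'v≡φ S ⇔-∘ same (extendAt v true S)

φAt-independent : ∀ {m} (B : Mat (suc m)) (τ : Transversal (suc m)) v → φAt B τ v → transverseMatroid B τ (singleton v)
φAt-independent B τ v (B' , _ , _ , τ' , τ'v≡φ , same) = from (same (singleton v)) (φ-independent B' τ' v τ'v≡φ)

relabel-others : ∀ {m} (B : Mat (suc m)) (τ : Transversal (suc m)) v x u j
               → col B (relabel τ v x) (punchIn v u) j ≡ col B τ (punchIn v u) j
relabel-others B τ v x u j = cong (λ l → iasColumn B l (punchIn v u) j) (relabel-off τ v x (punchIn v u) (punchInᵢ≢i v u))

coloopLabel : ∀ {m} (B : Mat (suc m)) → SymmetricMat B → (τ : Transversal (suc m)) → ∀ v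
            → Σ Label λ x → ¬ Spans (col B (relabel τ v x) ∘ punchIn v) (col B (relabel τ v x) v)
coloopLabel B sym-B τ v with spans? (col B (relabel τ v φ) ∘ punchIn v) (col B (relabel τ v φ) v)
                           | spans? (col B (relabel τ v χ) ∘ punchIn v) (col B (relabel τ v χ) v)
... | no notSpanned | _             = φ , notSpanned
... | yes _         | no notSpanned = χ , notSpanned
... | yes spannedφ  | yes spannedχ  = ⊥-elim (φχ-not-both-spanned B sym-B τ v
        (Spans-cong (relabel-others B τ v φ) (λ j → cong (λ l → iasColumn B l v j) (relabel-at τ v φ)) spannedφ)
        (Spans-cong (relabel-others B τ v χ) (λ j → cong (λ l → iasColumn B l v j) (relabel-at τ v χ)) spannedχ))

-- Deleting v: giving v a coloop label does not affect the sets avoiding v, and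
-- then deleting the coloop v is the same as adding it.
delete-realised : ∀ {m} (B : Mat (suc m)) → SymmetricMat B → (τ : Transversal (suc m)) → ∀ v
                → Realised B (deleteM (transverseMatroid B τ) v)
delete-realised {m} B sym-B τ v with coloopLabel B sym-B τ v
... | x , isColoop = Realised-cong
  (λ S → coloop (col B τx) v isColoop S ⇔-∘ avoiding-column (col B τ) (col B τx) v (λ u j → sym (relabel-others B τ v x u j)) S)
  (φAt-extend B τx v (makeφ B sym-B τx v nonzero))
  where
    τx = relabel τ v x
    -- a zero column would be spanned by the empty combination
    nonzero : ¬ (∀ j → col B τx v j ≡ false)
    nonzero zero-column = isColoop ((λ _ → false) , λ j → trans (xorSum-zero {m}) (sym (zero-column j)))

contract-realised : ∀ {m} (B : Mat (suc m)) → SymmetricMat B → (τ : Transversal (suc m)) → ∀ v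
                  → Realised B (contractM (transverseMatroid B τ) v)
contract-realised B sym-B τ v with all? (λ j → col B τ v j ≟ᴮ false)
... | yes zero-column = Realised-cong (contract-loop (transverseMatroid B τ) v (zero-dependent (col B τ) v zero-column)) (delete-realised B sym-B τ v)
... | no nonzero      = Realised-cong (contract-nonloop (transverseMatroid B τ) v (φAt-independent B τ v φ-at-v)) (φAt-extend B τ v φ-at-v)
  where φ-at-v = makeφ B sym-B τ v nonzero

minor-realised : ∀ {n} (A : Mat n) → SymmetricMat A → (τ : Transversal n)
               → ∀ {m} (N : Matroid m) → Minor (transverseMatroid A τ) N → Realised A N
minor-realised A sym-A τ N mn-refl = A , vm-refl , sym-A , τ , ≈M-refl
minor-realised A sym-A τ _ (mn-del {N = N} minor e) with minor-realised A sym-A τ N minor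
... | B , A≥B , sym-B , τB , N≈ =
  Realised-via A≥B (Realised-cong (λ S → N≈ (extendAt e false S)) (delete-realised B sym-B τB e))
minor-realised A sym-A τ _ (mn-con {N = N} minor e) with minor-realised A sym-A τ N minor
... | B , A≥B , sym-B , τB , N≈ =
  Realised-via A≥B (Realised-cong (contractM-cong e N≈) (contract-realised B sym-B τB e))

proposition54 : ∀ {n} (A : Mat n) → SymmetricMat A → (τ : Transversal n)
                → ∀ {m} (N : Matroid m) → Minor (transverseMatroid A τ) N
                → Σ (Mat m) λ B → VertexMinor A B × Σ (Transversal m) λ τ' → N ≅M transverseMatroid B τ'
proposition54 A sym-A τ N minor with minor-realised A sym-A τ N minor
... | B , A≥B , _ , τ' , N≈ = B , A≥B , τ' , ↔-id _ , N≈
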